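{- Let $m,n\ge 1$ and let $G$ be the ordered graph with vertices $v_1<\dots<v_{m+n}$ whose only edges are $v_1v_{m+1}$ and $v_mv_{m+n}$ (so $G$ is $2$-ichromatic with parts $\{v_1,\dots,v_m\}$ and $\{v_{m+1},\dots,v_{m+n}\}$, and has two crossing edges, one joining the first vertices of the two parts and one joining the last vertices of the two parts). Then $R(G) = m+n+\max(m,n)-1$.
   Context: An ordered graph is a graph together with a linear ordering of its vertices. An ordered graph $H$ is contained in an ordered graph $H'$ if there is an order-preserving injection $V(H)\to V(H')$ mapping edges to edges. The Ramsey number $R(G)$ of an ordered graph $G$ is the minimum $N$ such that every 2-coloring of the edges of the ordered complete graph on $N$ vertices contains a monochromatic copy of $G$ (in the ordered sense). -}

module Defs where

open import Level using (0ℓ)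
open import Data.Nat using (ℕ; _+_; _∸_; _<_)
open import Data.Nat using () renaming (_⊔_ to max)
open import Data.Fin using (Fin; toℕ) renaming (_<_ to _<ᶠ_)
open import Data.Bool using (Bool)
open import Data.Product using (Σ; _×_; ∃)
open import Data.Sum using (_⊎_)
open import Relation.Nullary using (¬_)
open import Relation.Binary.PropositionalEquality using (_≡_)

-- An ordered graph: vertex set Fin size with its natural linear order;
-- Edge i j is meaningful for i < j (an edge {i,j} with i < j).
record OrderedGraph : Set₁ where
  field
    size : ℕ
    Edge : Fin size → Fin size → Set

open OrderedGraph public

-- A 2-colouring of the edges of the ordered complete graph on N vertices:
-- the colour of edge {x,y} with x < y is χ x y.
Colouring : ℕ → Set
Colouring N = Fin N → Fin N → Bool

MonoCopy : (H : OrderedGraph) {N : ℕ} → Colouring N → Set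
MonoCopy H {N} χ =
  Σ (Fin (size H) → Fin N) λ f →
    ((i j : Fin (size H)) → i <ᶠ j → f i <ᶠ f j) ×
    ∃ λ (c : Bool) →
      (i j : Fin (size H)) → i <ᶠ j → Edge H i j → χ (f i) (f j) ≡ c

Arrows : ℕ → OrderedGraph → Set
Arrows N H = (χ : Colouring N) → MonoCopy H χ

IsRamseyNumber : OrderedGraph → ℕ → Set
IsRamseyNumber H N = Arrows N H × ((M : ℕ) → M < N → ¬ Arrows M H)

-- The graph G of the statement: vertices v_1 < ... < v_{m+n} are
-- indices 0 .. m+n-1; edges v_1 v_{m+1} and v_m v_{m+n}.
crossG : ℕ → ℕ → OrderedGraph
crossG m n = record
  { size = m + n
  ; Edge = λ i j →
      (toℕ i ≡ 0 × toℕ j ≡ m) ⊎ (toℕ i ≡ m ∸ 1 × toℕ j ≡ m + n ∸ 1)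
  }

ramseyValue : ℕ → ℕ → ℕ
ramseyValue m n = m + n + max m n ∸ 1

{-# OPTIONS --safe #-}
module Submission where

open import Defs
open import Data.Nat using (ℕ; zero; suc; _+_; _≤_; _<_; _<ᵇ_; _⊔_; z≤n; s≤s; NonZero)
open import Data.Nat.Properties
open import Data.Nat.DivMod using (_mod_; m<n⇒m%n≡m)
open import Data.Fin using (Fin; toℕ; fromℕ<) renaming (_<_ to _<ᶠ_)
open import Data.Fin.Properties using (toℕ-fromℕ<; toℕ<n; toℕ-injective)
open import Data.Bool using (Bool; true; false; T)
open import Data.Product using (∃; ∃₂; _×_; _,_; uncurry)
open import Data.Sum using (_⊎_; inj₁; inj₂)
open import Function using (_∘_; id)
open import Relation.Nullary using (¬_)
open import Relation.Binary.PropositionalEquality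

-- A copy of crossG (r + 1) (s + 1) amounts to two edges x₁y₁ and
-- x₂y₂ of the same colour with x₁ + r ≤ x₂ < y₁ and y₁ + s ≤ y₂ (a
-- monochromatic frame; for r = 0 or s = 0 the corresponding inequality becomes
-- an equality). On r + s + max r s + 2 vertices one finds five edges, each
-- forming a frame with the next one cyclically (three edges if r or s is 0);
-- an odd cycle has no proper 2-colouring, so some frame is monochromatic.
-- On one vertex fewer, colour an edge by whether its left end is below r
-- (if s ≤ r), or whether its right end is above r + s (if r ≤ s): the two
-- edges of any frame then receive different colours.

Ascending : ℕ → (ℕ → ℕ) → Set
Ascending L h = ∀ i → suc i < L → h i < h (suc i)

module _ {L : ℕ} {h : ℕ → ℕ} (asc : Ascending L h) where

  ascending-< : ∀ {i j} → i < j → j < L → h i < h j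
  ascending-< {j = suc j} i<1+j 1+j<L with m<1+n⇒m<n∨m≡n i<1+j
  ... | inj₁ i<j  = <-trans (ascending-< i<j (<-trans (n<1+n j) 1+j<L)) (asc j 1+j<L)
  ... | inj₂ refl = asc j 1+j<L

  ascending-≤ : ∀ {i j} → i ≤ j → j < L → h i ≤ h j
  ascending-≤ i≤j j<L with m≤n⇒m<n∨m≡n i≤j
  ... | inj₁ i<j  = <⇒≤ (ascending-< i<j j<L)
  ... | inj₂ refl = ≤-refl

  ascending-+ : ∀ i a → i + a < L → h i + a ≤ h (i + a)
  ascending-+ i zero _ = ≤-reflexive (trans (+-identityʳ (h i)) (cong h (sym (+-identityʳ i))))
  ascending-+ i (suc a) i+1+a<L =
    subst₂ _≤_ (sym (+-suc (h i) a)) (cong h (sym (+-suc i a)))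
      (≤-<-trans (ascending-+ i a (<-trans (n<1+n (i + a)) 1+i+a<L)) (asc (i + a) 1+i+a<L))
    where
    1+i+a<L : suc (i + a) < L
    1+i+a<L = subst (_< L) (+-suc i a) i+1+a<L

-- Span r a b: some strictly increasing sequence of r + 1 naturals starts at a
-- and ends at b.
Span : ℕ → ℕ → ℕ → Set
Span zero    a b = a ≡ b
Span (suc r) a b = a + suc r ≤ b

span-+ : ∀ r a → Span r a (a + r)
span-+ zero    a = sym (+-identityʳ a)
span-+ (suc r) a = ≤-refl

span⇒≤ : ∀ r {a b} → Span r a b → a + r ≤ b
span⇒≤ zero    {a} a≡b = ≤-reflexive (trans (+-identityʳ a) a≡b)
span⇒≤ (suc r)         = id

span-trans : ∀ r {a b c} → Span r a b → Span r b c → Span r a c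
span-trans zero                   = trans
span-trans (suc r) {b = b} a+r≤b b+r≤c = ≤-trans a+r≤b (≤-trans (m≤m+n b (suc r)) b+r≤c)

ascending-span : ∀ {L h} → Ascending L h → ∀ i a → i + a < L → Span a (h i) (h (i + a))
ascending-span {h = h} asc i zero    _ = cong h (sym (+-identityʳ i))
ascending-span         asc i (suc a)   = ascending-+ asc i (suc a)

stretch : ℕ → ℕ → ℕ → ℕ → ℕ
stretch zero    a b _       = b
stretch (suc r) a b zero    = a
stretch (suc r) a b (suc i) = stretch r (suc a) b i

stretch-head : ∀ r {a b} → Span r a b → stretch r a b 0 ≡ a
stretch-head zero    a≡b = sym a≡b
stretch-head (suc r) _   = refl

stretch-last : ∀ r a b → stretch r a b r ≡ b
stretch-last zero    a b = refl
stretch-last (suc r) a b = stretch-last r (suc a) b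

stretch-ascending : ∀ r {a b} → a + r ≤ b → Ascending (suc r) (stretch r a b)
stretch-ascending zero                _       _       (s≤s ())
stretch-ascending (suc zero)    {a} {b} a+1≤b zero    _ = subst (_≤ b) (+-comm a 1) a+1≤b
stretch-ascending (suc (suc r)) {a}   _       zero    _ = n<1+n a
stretch-ascending (suc r)       {a} {b} a+r≤b (suc i) (s≤s 1+i<1+r) =
  stretch-ascending r (subst (_≤ b) (+-suc a r) a+r≤b) i 1+i<1+r

splice : ℕ → (ℕ → ℕ) → (ℕ → ℕ) → ℕ → ℕ
splice r       u v zero    = u zero
splice zero    u v (suc i) = v i
splice (suc r) u v (suc i) = splice r (u ∘ suc) v i

splice-left : ∀ r u v {i} → i ≤ r → splice r u v i ≡ u i
splice-left r       u v {zero}  _         = refl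
splice-left (suc r) u v {suc i} (s≤s i≤r) = splice-left r (u ∘ suc) v i≤r

splice-right : ∀ r u v i → splice r u v (suc r + i) ≡ v i
splice-right zero    u v i = refl
splice-right (suc r) u v i = splice-right r (u ∘ suc) v i

splice-ascending : ∀ r {L u v} → Ascending (suc r) u → Ascending L v → u r < v 0 →
                   Ascending (suc r + L) (splice r u v)
splice-ascending zero    _     _     u0<v0 zero    _          = u0<v0
splice-ascending zero    _     asc-v _     (suc i) (s≤s 1+i<L) = asc-v i 1+i<L
splice-ascending (suc r) asc-u _     _     zero    _          = asc-u 0 (s≤s (s≤s z≤n))
splice-ascending (suc r) asc-u asc-v ur<v0 (suc i) (s≤s lt)   =
  splice-ascending r (λ j → asc-u (suc j) ∘ s≤s) asc-v ur<v0 i lt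

toℕ-mod : ∀ {n L} .{{_ : NonZero L}} → n < L → toℕ (n mod L) ≡ n
toℕ-mod n<L = trans (toℕ-fromℕ< _) (m<n⇒m%n≡m n<L)

-- The edges x₁y₁ and x₂y₂ of K_N can be the images of v₁v_{r+2} and
-- v_{r+1}v_{r+s+2} under an embedding of crossG (suc r) (suc s).
Frame : (r s N : ℕ) → ℕ × ℕ → ℕ × ℕ → Set
Frame r s N (x₁ , y₁) (x₂ , y₂) = Span r x₁ x₂ × x₂ < y₁ × Span s y₁ y₂ × y₂ < N

MonoFrame : (r s N : ℕ) → (ℕ → ℕ → Bool) → Set
MonoFrame r s N β = ∃₂ λ e f → Frame r s N e f × uncurry β e ≡ uncurry β f

Agrees : ∀ {N} → Colouring N → (ℕ → ℕ → Bool) → Set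
Agrees χ β = ∀ i j → χ i j ≡ β (toℕ i) (toℕ j)

extend : ∀ {N} .{{_ : NonZero N}} → Colouring N → ℕ → ℕ → Bool
extend {N} χ x y = χ (x mod N) (y mod N)

extend-agrees : ∀ {N} .{{_ : NonZero N}} (χ : Colouring N) → Agrees χ (extend χ)
extend-agrees {N} χ i j = cong₂ χ (sym (mod-toℕ i)) (sym (mod-toℕ j))
  where
  mod-toℕ : ∀ i → toℕ i mod N ≡ i
  mod-toℕ i = toℕ-injective (toℕ-mod (toℕ<n i))

monoFrame⇒monoCopy : ∀ {r s N} {χ : Colouring N} {β} → Agrees χ β →
                     MonoFrame r s N β → MonoCopy (crossG (suc r) (suc s)) χ
monoFrame⇒monoCopy {r} {s} {N} {χ} {β} agrees
  ((x₁ , y₁) , (x₂ , y₂) , (span₁ , x₂<y₁ , span₂ , y₂<N) , sameColour) =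
  f , f-mono , β x₁ y₁ , f-colour
  where
  h : ℕ → ℕ
  h = splice r (stretch r x₁ x₂) (stretch s y₁ y₂)

  h-ascending : Ascending (suc r + suc s) h
  h-ascending = splice-ascending r (stretch-ascending r (span⇒≤ r span₁))
    (stretch-ascending s (span⇒≤ s span₂))
    (subst₂ _<_ (sym (stretch-last r x₁ x₂)) (sym (stretch-head s span₂)) x₂<y₁)

  h-x₁ : h 0 ≡ x₁
  h-x₁ = stretch-head r span₁

  h-x₂ : h r ≡ x₂
  h-x₂ = trans (splice-left r _ _ ≤-refl) (stretch-last r x₁ x₂)

  h-y₁ : h (suc r) ≡ y₁
  h-y₁ = trans (cong h (sym (+-identityʳ (suc r))))
               (trans (splice-right r _ _ 0) (stretch-head s span₂))

  h-y₂ : h (r + suc s) ≡ y₂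
  h-y₂ = trans (cong h (+-suc r s)) (trans (splice-right r _ _ s) (stretch-last s y₁ y₂))

  h<N : ∀ i → i < suc r + suc s → h i < N
  h<N i (s≤s i≤r+1+s) =
    ≤-<-trans (ascending-≤ h-ascending i≤r+1+s ≤-refl) (subst (_< N) (sym h-y₂) y₂<N)

  f : Fin (suc r + suc s) → Fin N
  f i = fromℕ< (h<N (toℕ i) (toℕ<n i))

  toℕ-f : ∀ i → toℕ (f i) ≡ h (toℕ i)
  toℕ-f i = toℕ-fromℕ< _

  f-mono : ∀ i j → i <ᶠ j → f i <ᶠ f j
  f-mono i j i<j = subst₂ _<_ (sym (toℕ-f i)) (sym (toℕ-f j))
                          (ascending-< h-ascending i<j (toℕ<n j))

  χ-f : ∀ i j → χ (f i) (f j) ≡ β (h (toℕ i)) (h (toℕ j))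
  χ-f i j = trans (agrees (f i) (f j)) (cong₂ β (toℕ-f i) (toℕ-f j))

  f-colour : ∀ i j → i <ᶠ j → Edge (crossG (suc r) (suc s)) i j → χ (f i) (f j) ≡ β x₁ y₁
  f-colour i j _ (inj₁ (i≡0 , j≡1+r)) =
    trans (χ-f i j) (cong₂ β (trans (cong h i≡0) h-x₁) (trans (cong h j≡1+r) h-y₁))
  f-colour i j _ (inj₂ (i≡r , j≡last)) =
    trans (χ-f i j) (trans (cong₂ β (trans (cong h i≡r) h-x₂) (trans (cong h j≡last) h-y₂))
                           (sym sameColour))

monoCopy⇒monoFrame : ∀ {r s N} {χ : Colouring N} {β} → Agrees χ β →
                     MonoCopy (crossG (suc r) (suc s)) χ → MonoFrame r s N β
monoCopy⇒monoFrame {r} {s} {β = β} agrees (f , f-mono , c , f-colour) =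
  (g 0 , g (suc r)) , (g r , g (suc r + s)) ,
  ( ascending-span g-ascending 0 r r<L
  , g-ascending r 1+r<L
  , ascending-span g-ascending (suc r) s last<L
  , toℕ<n _ ) ,
  trans (colour 0 (suc r) (s≤s z≤n) 1+r<L (inj₁ (toℕ-mod 0<L , toℕ-mod 1+r<L)))
        (sym (colour r (suc r + s) (s≤s (m≤m+n r s)) last<L
               (inj₂ (toℕ-mod r<L , trans (toℕ-mod last<L) (sym (+-suc r s))))))
  where
  L : ℕ
  L = suc r + suc s

  at : ℕ → Fin L
  at n = n mod L

  -- g n is the position of the n-th vertex of the copy (mod only makes g total).
  g : ℕ → ℕ
  g n = toℕ (f (at n))

  last<L : suc r + s < L
  last<L = +-monoʳ-< (suc r) (n<1+n s)

  1+r<L : suc r < L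
  1+r<L = ≤-<-trans (m≤m+n (suc r) s) last<L

  r<L : r < L
  r<L = <-trans (n<1+n r) 1+r<L

  0<L : 0 < L
  0<L = s≤s z≤n

  at-< : ∀ {i j} → i < j → j < L → at i <ᶠ at j
  at-< i<j j<L = subst₂ _<_ (sym (toℕ-mod (<-trans i<j j<L))) (sym (toℕ-mod j<L)) i<j

  g-ascending : Ascending L g
  g-ascending i 1+i<L = f-mono (at i) (at (suc i)) (at-< (n<1+n i) 1+i<L)

  colour : ∀ i j → i < j → j < L → Edge (crossG (suc r) (suc s)) (at i) (at j) →
           β (g i) (g j) ≡ c
  colour i j i<j j<L edge = trans (sym (agrees _ _)) (f-colour _ _ (at-< i<j j<L) edge)

oddCycle₃ : (a b c : Bool) → a ≡ b ⊎ b ≡ c ⊎ c ≡ a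
oddCycle₃ false false _     = inj₁ refl
oddCycle₃ true  true  _     = inj₁ refl
oddCycle₃ _     false false = inj₂ (inj₁ refl)
oddCycle₃ _     true  true  = inj₂ (inj₁ refl)
oddCycle₃ false true  false = inj₂ (inj₂ refl)
oddCycle₃ true  false true  = inj₂ (inj₂ refl)

oddCycle₅ : (a b c d e : Bool) → a ≡ b ⊎ b ≡ c ⊎ c ≡ d ⊎ d ≡ e ⊎ e ≡ a
oddCycle₅ false false _     _     _     = inj₁ refl
oddCycle₅ true  true  _     _     _     = inj₁ refl
oddCycle₅ _     false false _     _     = inj₂ (inj₁ refl)
oddCycle₅ _     true  true  _     _     = inj₂ (inj₁ refl)
oddCycle₅ _     _     false false _     = inj₂ (inj₂ (inj₁ refl))
oddCycle₅ _     _     true  true  _     = inj₂ (inj₂ (inj₁ refl))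
oddCycle₅ _     _     _     false false = inj₂ (inj₂ (inj₂ (inj₁ refl)))
oddCycle₅ _     _     _     true  true  = inj₂ (inj₂ (inj₂ (inj₁ refl)))
oddCycle₅ false true  false true  false = inj₂ (inj₂ (inj₂ (inj₂ refl)))
oddCycle₅ true  false true  false true  = inj₂ (inj₂ (inj₂ (inj₂ refl)))

Linked : (r s N : ℕ) → ℕ × ℕ → ℕ × ℕ → Set
Linked r s N e f = Frame r s N e f ⊎ Frame r s N f e

module _ {r s N : ℕ} (β : ℕ → ℕ → Bool) where

  monoFrame-of-linked : ∀ {e f} → Linked r s N e f → uncurry β e ≡ uncurry β f →
                        MonoFrame r s N β
  monoFrame-of-linked (inj₁ frame) same = _ , _ , frame , same
  monoFrame-of-linked (inj₂ frame) same = _ , _ , frame , sym same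

  monoFrame-of-cycle₃ : ∀ {e₁ e₂ e₃} →
    Linked r s N e₁ e₂ → Linked r s N e₂ e₃ → Linked r s N e₃ e₁ → MonoFrame r s N β
  monoFrame-of-cycle₃ {e₁} {e₂} {e₃} l₁₂ l₂₃ l₃₁
    with oddCycle₃ (uncurry β e₁) (uncurry β e₂) (uncurry β e₃)
  ... | inj₁ same        = monoFrame-of-linked l₁₂ same
  ... | inj₂ (inj₁ same) = monoFrame-of-linked l₂₃ same
  ... | inj₂ (inj₂ same) = monoFrame-of-linked l₃₁ same

  monoFrame-of-cycle₅ : ∀ {e₁ e₂ e₃ e₄ e₅} →
    Linked r s N e₁ e₂ → Linked r s N e₂ e₃ → Linked r s N e₃ e₄ →
    Linked r s N e₄ e₅ → Linked r s N e₅ e₁ → MonoFrame r s N β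
  monoFrame-of-cycle₅ {e₁} {e₂} {e₃} {e₄} {e₅} l₁₂ l₂₃ l₃₄ l₄₅ l₅₁
    with oddCycle₅ (uncurry β e₁) (uncurry β e₂) (uncurry β e₃) (uncurry β e₄) (uncurry β e₅)
  ... | inj₁ same                      = monoFrame-of-linked l₁₂ same
  ... | inj₂ (inj₁ same)               = monoFrame-of-linked l₂₃ same
  ... | inj₂ (inj₂ (inj₁ same))        = monoFrame-of-linked l₃₄ same
  ... | inj₂ (inj₂ (inj₂ (inj₁ same))) = monoFrame-of-linked l₄₅ same
  ... | inj₂ (inj₂ (inj₂ (inj₂ same))) = monoFrame-of-linked l₅₁ same

monoFrame-≥ : ∀ {r s N} β → s ≤ r → suc (r + r + s) < N → MonoFrame r s N β
monoFrame-≥ {r} {zero} {N} β _ t<N =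
  monoFrame-of-cycle₃ β {0 , t} {r , t} {r + r , t}
    (inj₁ (frame (span-+ r 0) (s≤s (≤-trans (m≤m+n r r) (m≤m+n (r + r) 0)))))
    (inj₁ (frame (span-+ r r) r+r<t))
    (inj₂ (frame (span-trans r (span-+ r 0) (span-+ r r)) r+r<t))
  where
  t : ℕ
  t = suc (r + r + 0)

  r+r<t : r + r < t
  r+r<t = s≤s (m≤m+n (r + r) 0)

  frame : ∀ {x₁ x₂} → Span r x₁ x₂ → x₂ < t → Frame r 0 N (x₁ , t) (x₂ , t)
  frame span x₂<t = span , x₂<t , refl , t<N
monoFrame-≥ {zero}      {suc _}     β ()  _
monoFrame-≥ {r@(suc _)} {s@(suc _)} β s≤r t<N =
  monoFrame-of-cycle₅ β {0 , suc r} {r , t} {0 , suc (r + r)} {r + r , t} {r , suc (r + r)}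
    (inj₁ (≤-refl , ≤-refl , s≤s (+-monoˡ-≤ s (m≤n+m r r)) , t<N))
    (inj₂ (≤-refl , s≤s (m≤m+n r r) , ≤-refl , t<N))
    (inj₁ (m≤n+m r r , ≤-refl , ≤-refl , t<N))
    (inj₂ (≤-refl , ≤-refl , ≤-refl , t<N))
    (inj₂ (≤-refl , ≤-refl , s≤s (+-monoʳ-≤ r s≤r) , ≤-<-trans (s≤s (m≤m+n (r + r) s)) t<N))
  where
  t : ℕ
  t = suc (r + r + s)

monoFrame-≤ : ∀ {r s N} β → r ≤ s → suc (r + s + s) < N → MonoFrame r s N β
monoFrame-≤ {zero} {s} {N} β _ t<N =
  monoFrame-of-cycle₃ β {0 , 1} {0 , suc s} {0 , t}
    (inj₁ (frame (span-+ s 1) (≤-<-trans (s≤s (m≤m+n s s)) t<N)))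
    (inj₁ (frame (span-+ s (suc s)) t<N))
    (inj₂ (frame (span-trans s (span-+ s 1) (span-+ s (suc s))) t<N))
  where
  t : ℕ
  t = suc (s + s)

  frame : ∀ {y₁ y₂} → Span s (suc y₁) y₂ → y₂ < N → Frame 0 s N (0 , suc y₁) (0 , y₂)
  frame span y₂<N = refl , s≤s z≤n , span , y₂<N
monoFrame-≤ {suc _}     {zero}      β ()  _
monoFrame-≤ {r@(suc _)} {s@(suc _)} β r≤s t<N =
  monoFrame-of-cycle₅ β {r + s , t} {0 , suc (r + s)} {r , t} {0 , suc r} {r , suc (r + s)}
    (inj₂ (m≤m+n r s , ≤-refl , ≤-refl , t<N))
    (inj₁ (≤-refl , s≤s (m≤m+n r s) , ≤-refl , t<N))
    (inj₂ (≤-refl , ≤-refl , s≤s (m≤m+n (r + s) s) , t<N))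
    (inj₁ (≤-refl , ≤-refl , ≤-refl , ≤-<-trans (s≤s (m≤m+n (r + s) s)) t<N))
    (inj₁ (+-monoʳ-≤ r r≤s , ≤-refl , ≤-refl , t<N))
  where
  t : ℕ
  t = suc (r + s + s)

noMonoFrame-left : ∀ {r s N} → N ≤ suc (r + r + s) → ¬ MonoFrame r s N (λ x _ → x <ᵇ r)
noMonoFrame-left {r} {s} N≤t ((x₁ , y₁) , (x₂ , y₂) , (span₁ , x₂<y₁ , span₂ , y₂<N) , same) =
  <⇒≱ x₂<r r≤x₂
  where
  r≤x₂ : r ≤ x₂
  r≤x₂ = ≤-trans (m≤n+m r x₁) (span⇒≤ r span₁)

  far : r ≤ x₁ → suc (r + r + s) ≤ y₂
  far r≤x₁ = ≤-trans (+-monoˡ-< s (≤-<-trans (≤-trans (+-monoˡ-≤ r r≤x₁) (span⇒≤ r span₁)) x₂<y₁))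
                     (span⇒≤ s span₂)

  x₁<r : x₁ < r
  x₁<r = ≰⇒> λ r≤x₁ → <⇒≱ y₂<N (≤-trans N≤t (far r≤x₁))

  x₂<r : x₂ < r
  x₂<r = <ᵇ⇒< x₂ r (subst T same (<⇒<ᵇ x₁<r))

noMonoFrame-right : ∀ {r s N} → N ≤ suc (r + s + s) → ¬ MonoFrame r s N (λ _ y → r + s <ᵇ y)
noMonoFrame-right {r} {s} N≤t ((x₁ , y₁) , (x₂ , y₂) , (span₁ , x₂<y₁ , span₂ , y₂<N) , same) =
  <⇒≱ y₂<N (≤-trans N≤t (≤-trans (+-monoˡ-< s r+s<y₁) (span⇒≤ s span₂)))
  where
  r+s<y₂ : r + s < y₂
  r+s<y₂ = <-≤-trans (+-monoˡ-< s (≤-<-trans (≤-trans (m≤n+m r x₁) (span⇒≤ r span₁)) x₂<y₁))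
                     (span⇒≤ s span₂)

  r+s<y₁ : r + s < y₁
  r+s<y₁ = <ᵇ⇒< (r + s) y₁ (subst T (sym same) (<⇒<ᵇ r+s<y₂))

ramseyValue-suc : ∀ r s → ramseyValue (suc r) (suc s) ≡ suc (suc (r + s + (r ⊔ s)))
ramseyValue-suc r s = begin
  r + suc s + suc (r ⊔ s)       ≡⟨ +-suc (r + suc s) (r ⊔ s) ⟩
  suc (r + suc s + (r ⊔ s))     ≡⟨ cong (λ a → suc (a + (r ⊔ s))) (+-suc r s) ⟩
  suc (suc (r + s + (r ⊔ s)))   ∎
  where open ≡-Reasoning

ramseyValue-≥ : ∀ {r s} → s ≤ r → ramseyValue (suc r) (suc s) ≡ suc (suc (r + r + s))
ramseyValue-≥ {r} {s} s≤r = trans (ramseyValue-suc r s) (cong (suc ∘ suc) (begin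
  r + s + (r ⊔ s) ≡⟨ cong (r + s +_) (m≥n⇒m⊔n≡m s≤r) ⟩
  r + s + r       ≡⟨ +-assoc r s r ⟩
  r + (s + r)     ≡⟨ cong (r +_) (+-comm s r) ⟩
  r + (r + s)     ≡⟨ +-assoc r r s ⟨
  r + r + s       ∎))
  where open ≡-Reasoning

ramseyValue-≤ : ∀ {r s} → r ≤ s → ramseyValue (suc r) (suc s) ≡ suc (suc (r + s + s))
ramseyValue-≤ {r} {s} r≤s =
  trans (ramseyValue-suc r s) (cong (λ a → suc (suc (r + s + a))) (m≤n⇒m⊔n≡n r≤s))

isRamseyNumber-crossG : ∀ {r s t} → ramseyValue (suc r) (suc s) ≡ suc t →
  (∀ {N} β → t < N → MonoFrame r s N β) →
  (∀ {N} → N ≤ t → ∃ λ β → ¬ MonoFrame r s N β) →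
  IsRamseyNumber (crossG (suc r) (suc s)) (ramseyValue (suc r) (suc s))
isRamseyNumber-crossG {r} {s} {t} R≡1+t monoFrame noMonoFrame rewrite R≡1+t = arrows , noArrows
  where
  arrows : Arrows (suc t) (crossG (suc r) (suc s))
  arrows χ = monoFrame⇒monoCopy (extend-agrees χ) (monoFrame (extend χ) ≤-refl)

  noArrows : ∀ M → M < suc t → ¬ Arrows M (crossG (suc r) (suc s))
  noArrows M (s≤s M≤t) arrows-M with noMonoFrame M≤t
  ... | β , noFrame =
    noFrame (monoCopy⇒monoFrame (λ _ _ → refl) (arrows-M (λ i j → β (toℕ i) (toℕ j))))

proposition2 : (m n : ℕ) → 1 ≤ m → 1 ≤ n → IsRamseyNumber (crossG m n) (ramseyValue m n)
proposition2 (suc r) (suc s) _ _ with ≤-total s r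
... | inj₁ s≤r = isRamseyNumber-crossG (ramseyValue-≥ s≤r)
                   (λ β → monoFrame-≥ β s≤r) (λ N≤t → _ , noMonoFrame-left N≤t)
... | inj₂ r≤s = isRamseyNumber-crossG (ramseyValue-≤ r≤s)
                   (λ β → monoFrame-≤ β r≤s) (λ N≤t → _ , noMonoFrame-right N≤t)
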